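{- Let $C$ be an admissible column with entries in $[\pm n]$ and let $C^0$ be the column whose entries are $\overline c$ for $c\in C$ (i.e. $C$ rotated by $\pi$ and complemented). Then $\ell(C^0)=(rC)^0$ and $r(C^0)=(\ell C)^0$; equivalently, the split $(\ell C^0, rC^0)$ is the $\pi$-rotation and complement of the split $(\ell C, rC)$.
   Context: $[\pm n]=\{1,\dots,n,\overline n,\dots,\overline1\}$ ($\overline i=-i$, $\overline{\overline i}=i$), ordered $1<\dots<n<\overline n<\dots<\overline1$. A column is a strictly increasing (top to bottom) sequence in $[\pm n]$; it is admissible if whenever $i,\overline i$ both occur, with $i$ in row $a$ from the top and $\overline i$ in row $b$ from the bottom, $a+b\le i$ (if $C$ is admissible so is $C^0$). For admissible $C$ with $z_1>\dots>z_r$ the $z\in[n]$ with $z,\overline z\in C$, let $t_1$ be the greatest $t\in[n]$ with $t<z_1$, $t,\overline t\notin C$, and $t_k$ the greatest $t\in[n]$ with $t<\min(t_{k-1},z_k)$, $t,\overline t\notin C$. The right column $rC$ replaces each $\overline{z_k}$ by $\overline{t_k}$ and reorders; the left column $\ell C$ replaces each $z_k$ by $t_k$ and reorders. For a column $D$, $D^0$ denotes the column with entries $\overline d$, $d\in D$, in increasing order. -}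

module Defs where

open import Data.Nat as ℕ using (ℕ; zero; suc; _+_; _∸_; _≤_; _⊓_)
open import Data.Fin as Fin using (Fin; toℕ; _↑ˡ_; opposite)
open import Data.Fin.Properties using (≤-decTotalOrder) renaming (_≟_ to _≟ᶠ_)
open import Data.Bool using (Bool; true; false; not; _∧_; if_then_else_)
open import Data.List using (List; []; _∷_; map; filter; length; lookup; reverse; allFin; last)
open import Data.List.Membership.DecPropositional using ()
open import Data.List.Relation.Unary.Linked using (Linked)
open import Data.List.Relation.Unary.Any using (any?)
open import Data.Maybe using (Maybe; just; nothing; _>>=_)
open import Data.Product using (_×_; _,_)
open import Relation.Nullary using (¬_; Dec; yes; no; does)
open import Relation.Nullary.Decidable using (_×-dec_; ¬?)
open import Relation.Binary.PropositionalEquality using (_≡_)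
import Data.List.Sort.InsertionSort.Base as Sort

-- Elements of [±n] = {1,…,n, n̄,…,1̄} are encoded as Fin (n + n), with the
-- natural order of Fin: index k < n encodes the unbarred letter k+1, and
-- the barring i ↦ ī is Fin.opposite (so index 2n-1-k encodes the bar of k+1).
Elt : ℕ → Set
Elt n = Fin (n + n)

pos : ∀ {n} → Fin n → Elt n
pos {n} i = i ↑ˡ n

bar : ∀ {n} → Fin n → Elt n
bar i = opposite (pos i)

neg : ∀ {n} → Elt n → Elt n
neg = opposite

sortCol : ∀ {n} → List (Elt n) → List (Elt n)
sortCol {n} = Sort.sort (≤-decTotalOrder (n + n))

-- a column: a strictly increasing (top to bottom) list of elements of [±n]
IsColumn : ∀ {n} → List (Elt n) → Set
IsColumn = Linked Fin._<_

-- admissibility: if i = pos j and ī = bar j both occur, with i in row a from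
-- the top and ī in row b from the bottom (rows counted from 1), then a + b ≤ i.
Admissible : ∀ {n} → List (Elt n) → Set
Admissible {n} C =
  (j : Fin n) (p q : Fin (length C)) →
  lookup C p ≡ pos j → lookup C q ≡ bar j →
  suc (toℕ p) + (length C ∸ toℕ q) ≤ suc (toℕ j)

_⁰ : ∀ {n} → List (Elt n) → List (Elt n)
_⁰ {n} D = sortCol {n} (map (neg {n}) D)

_∈ᵇ_ : ∀ {n} → Elt n → List (Elt n) → Bool
_∈ᵇ_ {n} x C = does (any? (x ≟ᶠ_) C)

freeᵇ : ∀ {n} → List (Elt n) → Fin n → Bool
freeᵇ {n} C t = not (_∈ᵇ_ {n} (pos t) C) ∧ not (_∈ᵇ_ {n} (bar t) C)

pairedᵇ : ∀ {n} → List (Elt n) → Fin n → Bool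
pairedᵇ {n} C z = (_∈ᵇ_ {n} (pos z) C) ∧ (_∈ᵇ_ {n} (bar z) C)

zs : ∀ {n} → List (Elt n) → List (Fin n)
zs {n} C = reverse (filter (λ z → pairedᵇ C z Data.Bool.≟ true) (allFin n))

greatestFree : ∀ {n} → List (Elt n) → ℕ → Maybe (Fin n)
greatestFree {n} C b =
  last (filter (λ t → (toℕ t ℕ.<? b) ×-dec (freeᵇ C t Data.Bool.≟ true)) (allFin n))

-- t_k = greatest free t < min(t_{k-1}, z_k)   (t_0 := +∞, encoded as n)
tsFrom : ∀ {n} → List (Elt n) → ℕ → List (Fin n) → Maybe (List (Fin n))
tsFrom C prev [] = just []
tsFrom C prev (z ∷ rest) =
  greatestFree C (prev ⊓ toℕ z) >>= λ t →
  tsFrom C (toℕ t) rest >>= λ ts → just (t ∷ ts)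

ts : ∀ {n} → List (Elt n) → Maybe (List (Fin n))
ts {n} C = tsFrom C n (zs {n} C)

replace : ∀ {n} → List (Elt n × Elt n) → Elt n → Elt n
replace [] c = c
replace {n} ((x , y) ∷ tbl) c = if does (_≟ᶠ_ {n + n} c x) then y else replace {n} tbl c

zipPairs : ∀ {A B : Set} → List A → List B → List (A × B)
zipPairs (a ∷ as) (b ∷ bs) = (a , b) ∷ zipPairs as bs
zipPairs _ _ = []

rCol : ∀ {n} → List (Elt n) → Maybe (List (Elt n))
rCol {n} C = ts {n} C >>= λ tks →
  just (sortCol {n} (map (replace {n} (zipPairs (map bar (zs {n} C)) (map bar tks))) C))

ℓCol : ∀ {n} → List (Elt n) → Maybe (List (Elt n))
ℓCol {n} C = ts {n} C >>= λ tks →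
  just (sortCol {n} (map (replace {n} (zipPairs (map pos (zs {n} C)) (map pos tks))) C))

-- The construction of ℓC and rC only sees C through the predicates
-- "z, z̄ ∈ C" and "t, t̄ ∉ C", both symmetric under barring, so C and C⁰ have
-- the same z's and t's.  Barring the entries of C therefore turns each
-- replacement z̄ₖ ↦ t̄ₖ into zₖ ↦ tₖ and vice versa, and sorting commutes with
-- this because sorting only depends on the multiset of entries.
module Submission where

open import Defs
open import Data.Nat using (ℕ)
open import Data.List using (List)
open import Data.Maybe using (Maybe)
import Data.Maybe
open import Data.Product using (_×_)
open import Relation.Binary.PropositionalEquality using (_≡_)

open import Data.Nat using (_+_; _⊓_)
open import Data.Fin using (Fin; toℕ)
open import Data.Fin.Properties using (≤-decTotalOrder; opposite-involutive)
  renaming (_≟_ to _≟ᶠ_)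
open import Data.Bool using (not)
open import Data.Bool.Properties using (∧-comm)
open import Data.List using ([]; _∷_; map; filter; allFin; reverse; last)
open import Data.List.Properties using (map-cong; map-∘; filter-≐)
open import Data.List.Membership.Propositional using (_∈_)
open import Data.List.Membership.Propositional.Properties using (∈-map⁺; ∈-map⁻)
open import Data.List.Relation.Unary.Any using (any?)
open import Data.List.Relation.Binary.Permutation.Propositional
  using (_↭_; ↭-sym; ↭-trans; ↭⇒↭ₛ; module PermutationReasoning)
open import Data.List.Relation.Binary.Permutation.Propositional.Properties using (Any-resp-↭; map⁺)
import Data.List.Sort.InsertionSort.Properties as InsertionSort
open import Data.List.Relation.Unary.Sorted.TotalOrder.Properties using (↗↭↗⇒≋)
open import Data.List.Relation.Binary.Pointwise using (Pointwise-≡⇒≡)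
open import Data.Maybe using (just; nothing; _>>=_)
import Data.Product as ×
open import Data.Product using (_,_)
open import Function using (_∘_; _⇔_; mk⇔)
open import Relation.Binary.Bundles using (DecTotalOrder)
open import Relation.Binary.PropositionalEquality
  using (refl; sym; trans; cong; cong₂; subst; _≗_; module ≡-Reasoning)
open import Relation.Nullary using (yes; no)
open import Relation.Nullary.Decidable using (does-⇔)
open import Data.Empty using (⊥-elim)

module _ {n : ℕ} where

  private
    Eltᴼ = ≤-decTotalOrder (n + n)

  sortCol-↭ : (xs : List (Elt n)) → sortCol {n} xs ↭ xs
  sortCol-↭ = InsertionSort.sort-↭ Eltᴼ

  sortCol-resp-↭ : {xs ys : List (Elt n)} → xs ↭ ys → sortCol {n} xs ≡ sortCol {n} ys
  sortCol-resp-↭ {xs} {ys} xs↭ys = Pointwise-≡⇒≡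
    (↗↭↗⇒≋ (DecTotalOrder.totalOrder Eltᴼ)
      (InsertionSort.sort-↗ Eltᴼ xs) (InsertionSort.sort-↗ Eltᴼ ys)
      (↭⇒↭ₛ (↭-trans (sortCol-↭ xs) (↭-trans xs↭ys (↭-sym (sortCol-↭ ys))))))

  ∈ᵇ-resp-↭ : (x : Elt n) {xs ys : List (Elt n)} → xs ↭ ys →
              _∈ᵇ_ {n} x xs ≡ _∈ᵇ_ {n} x ys
  ∈ᵇ-resp-↭ x {xs} {ys} xs↭ys =
    does-⇔ (mk⇔ (Any-resp-↭ xs↭ys) (Any-resp-↭ (↭-sym xs↭ys)))
      (any? (x ≟ᶠ_) xs) (any? (x ≟ᶠ_) ys)

  neg-injective : {x y : Elt n} → neg {n} x ≡ neg {n} y → x ≡ y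
  neg-injective {x} {y} eq =
    trans (sym (opposite-involutive x)) (trans (cong (neg {n}) eq) (opposite-involutive y))

  ∈-map-neg⇔ : (x : Elt n) (xs : List (Elt n)) → x ∈ map (neg {n}) xs ⇔ neg {n} x ∈ xs
  ∈-map-neg⇔ x xs = mk⇔ to from
    where
    to : x ∈ map (neg {n}) xs → neg {n} x ∈ xs
    to x∈ with c , c∈xs , x≡c̄ ← ∈-map⁻ (neg {n}) x∈ =
      subst (_∈ xs) (sym (neg-injective (trans (opposite-involutive x) x≡c̄))) c∈xs
    from : neg {n} x ∈ xs → x ∈ map (neg {n}) xs
    from x̄∈xs =
      subst (_∈ map (neg {n}) xs) (opposite-involutive x) (∈-map⁺ (neg {n}) x̄∈xs)

  ∈ᵇ-⁰ : (x : Elt n) (C : List (Elt n)) →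
         _∈ᵇ_ {n} x (_⁰ {n} C) ≡ _∈ᵇ_ {n} (neg {n} x) C
  ∈ᵇ-⁰ x C = trans (∈ᵇ-resp-↭ x (sortCol-↭ (map (neg {n}) C)))
    (does-⇔ (∈-map-neg⇔ x C) (any? (x ≟ᶠ_) (map (neg {n}) C)) (any? (neg {n} x ≟ᶠ_) C))

  neg-bar : (z : Fin n) → neg {n} (bar z) ≡ pos z
  neg-bar z = opposite-involutive (pos z)

  pairedᵇ-⁰ : (C : List (Elt n)) → pairedᵇ {n} (_⁰ {n} C) ≗ pairedᵇ {n} C
  pairedᵇ-⁰ C z rewrite ∈ᵇ-⁰ (pos z) C | ∈ᵇ-⁰ (bar z) C | neg-bar z =
    ∧-comm (_∈ᵇ_ {n} (bar z) C) (_∈ᵇ_ {n} (pos z) C)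

  freeᵇ-⁰ : (C : List (Elt n)) → freeᵇ {n} (_⁰ {n} C) ≗ freeᵇ {n} C
  freeᵇ-⁰ C z rewrite ∈ᵇ-⁰ (pos z) C | ∈ᵇ-⁰ (bar z) C | neg-bar z =
    ∧-comm (not (_∈ᵇ_ {n} (bar z) C)) (not (_∈ᵇ_ {n} (pos z) C))

  zs-cong : {C D : List (Elt n)} → pairedᵇ {n} C ≗ pairedᵇ {n} D → zs {n} C ≡ zs {n} D
  zs-cong eq = cong reverse (filter-≐ _ _
    ((λ {z} p → trans (sym (eq z)) p) , (λ {z} p → trans (eq z) p)) (allFin n))

  greatestFree-cong : {C D : List (Elt n)} → freeᵇ {n} C ≗ freeᵇ {n} D →
                      (b : ℕ) → greatestFree {n} C b ≡ greatestFree {n} D b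
  greatestFree-cong eq b = cong last (filter-≐ _ _
    ( (λ {t} (t<b , p) → t<b , trans (sym (eq t)) p)
    , (λ {t} (t<b , p) → t<b , trans (eq t) p)) (allFin n))

  tsFrom-cong : {C D : List (Elt n)} → freeᵇ {n} C ≗ freeᵇ {n} D →
                (prev : ℕ) (zl : List (Fin n)) → tsFrom {n} C prev zl ≡ tsFrom {n} D prev zl
  tsFrom-cong eq prev [] = refl
  tsFrom-cong {C} {D} eq prev (z ∷ zl) rewrite greatestFree-cong {C} {D} eq (prev ⊓ toℕ z)
    with greatestFree {n} D (prev ⊓ toℕ z)
  ... | nothing = refl
  ... | just t  = cong (_>>= λ tks → just (t ∷ tks)) (tsFrom-cong eq (toℕ t) zl)

  ts-⁰ : (C : List (Elt n)) → ts {n} (_⁰ {n} C) ≡ ts {n} C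
  ts-⁰ C rewrite zs-cong {_⁰ {n} C} {C} (pairedᵇ-⁰ C) = tsFrom-cong (freeᵇ-⁰ C) n (zs {n} C)

  replace-neg : (tbl : List (Elt n × Elt n)) (c : Elt n) →
                replace {n} (map (×.map (neg {n}) (neg {n})) tbl) (neg {n} c)
                  ≡ neg {n} (replace {n} tbl c)
  replace-neg [] c = refl
  replace-neg ((x , y) ∷ tbl) c with neg {n} c ≟ᶠ neg {n} x | c ≟ᶠ x
  ... | yes _     | yes _    = refl
  ... | yes c̄≡x̄  | no c≢x   = ⊥-elim (c≢x (neg-injective c̄≡x̄))
  ... | no c̄≢x̄   | yes c≡x  = ⊥-elim (c̄≢x̄ (cong (neg {n}) c≡x))
  ... | no _      | no _     = replace-neg tbl c

  sortCol-replace-⁰ : (tbl : List (Elt n × Elt n)) (C : List (Elt n)) →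
    sortCol {n} (map (replace {n} (map (×.map (neg {n}) (neg {n})) tbl)) (_⁰ {n} C))
      ≡ _⁰ {n} (sortCol {n} (map (replace {n} tbl) C))
  sortCol-replace-⁰ tbl C = sortCol-resp-↭ (begin
    map R̄ (sortCol {n} (map negₙ C))  ↭⟨ map⁺ R̄ (sortCol-↭ (map negₙ C)) ⟩
    map R̄ (map negₙ C)                ≡⟨ map-∘ C ⟨
    map (R̄ ∘ negₙ) C                  ≡⟨ map-cong (replace-neg tbl) C ⟩
    map (negₙ ∘ R) C                  ≡⟨ map-∘ C ⟩
    map negₙ (map R C)                ↭⟨ map⁺ negₙ (sortCol-↭ (map R C)) ⟨
    map negₙ (sortCol {n} (map R C))  ∎)
    where
    open PermutationReasoning
    negₙ = neg {n}
    R = replace {n} tbl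
    R̄ = replace {n} (map (×.map negₙ negₙ) tbl)

zipPairs-map : {A B A′ B′ : Set} (f : A → A′) (g : B → B′) (as : List A) (bs : List B) →
               map (×.map f g) (zipPairs as bs) ≡ zipPairs (map f as) (map g bs)
zipPairs-map f g []       bs       = refl
zipPairs-map f g (a ∷ as) []       = refl
zipPairs-map f g (a ∷ as) (b ∷ bs) = cong (_ ∷_) (zipPairs-map f g as bs)

-- ℓCol = replaceZsCol pos and rCol = replaceZsCol bar, definitionally.
replaceZsCol : ∀ {n} → (Fin n → Elt n) → List (Elt n) → Maybe (List (Elt n))
replaceZsCol {n} f C = ts {n} C >>= λ tks →
  just (sortCol {n} (map (replace {n} (zipPairs (map f (zs {n} C)) (map f tks))) C))

module _ {n : ℕ} (f g : Fin n → Elt n) (neg∘f≗g : neg {n} ∘ f ≗ g) where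

  zipPairs-neg : (as bs : List (Fin n)) →
    zipPairs (map g as) (map g bs)
      ≡ map (×.map (neg {n}) (neg {n})) (zipPairs (map f as) (map f bs))
  zipPairs-neg as bs = begin
    zipPairs (map g as) (map g bs)
      ≡⟨ cong₂ zipPairs (map-cong neg∘f≗g as) (map-cong neg∘f≗g bs) ⟨
    zipPairs (map (neg {n} ∘ f) as) (map (neg {n} ∘ f) bs)
      ≡⟨ cong₂ zipPairs (map-∘ as) (map-∘ bs) ⟩
    zipPairs (map (neg {n}) (map f as)) (map (neg {n}) (map f bs))
      ≡⟨ zipPairs-map (neg {n}) (neg {n}) (map f as) (map f bs) ⟨
    map (×.map (neg {n}) (neg {n})) (zipPairs (map f as) (map f bs)) ∎
    where open ≡-Reasoning

  replaceZsCol-⁰ : (C : List (Elt n)) →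
    replaceZsCol g (_⁰ {n} C) ≡ Data.Maybe.map (_⁰ {n}) (replaceZsCol f C)
  replaceZsCol-⁰ C rewrite ts-⁰ {n} C | zs-cong {n} {_⁰ {n} C} {C} (pairedᵇ-⁰ C)
    with ts {n} C
  ... | nothing  = refl
  ... | just tks = cong just (trans
    (cong (λ tbl → sortCol {n} (map (replace {n} tbl) (_⁰ {n} C))) (zipPairs-neg (zs {n} C) tks))
    (sortCol-replace-⁰ {n} (zipPairs (map f (zs {n} C)) (map f tks)) C))

lemma5p7 : (n : ℕ) (C : List (Elt n)) → IsColumn {n} C → Admissible {n} C →
    (ℓCol {n} (_⁰ {n} C) ≡ Data.Maybe.map (_⁰ {n}) (rCol {n} C))
      × (rCol {n} (_⁰ {n} C) ≡ Data.Maybe.map (_⁰ {n}) (ℓCol {n} C))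
lemma5p7 n C _ _ =
  replaceZsCol-⁰ {n} bar pos neg-bar C , replaceZsCol-⁰ {n} pos bar (λ _ → refl) C
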